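{- Let $n\ge 1$ and let $f_i(x) = a_i x + b_i$, for $i = 1, \ldots, n$, be affine maps of $\mathbb{R}$ where each $a_i$ is a positive integer and each $b_i \in \mathbb{Q}$. If $$\frac{1}{a_1} + \cdots + \frac{1}{a_n} > 1,$$ then the semigroup $S = \langle f_1, \ldots, f_n\rangle$ is not free with free basis $f_1,\dots,f_n$; that is, there exist two distinct finite nonempty sequences of indices $(i_1,\dots,i_k)$ and $(j_1,\dots,j_l)$ in $\{1,\dots,n\}$ with $f_{i_1}\circ\cdots\circ f_{i_k} = f_{j_1}\circ\cdots\circ f_{j_l}$.
   Context: $\langle f_1,\dots,f_n\rangle$ denotes the semigroup generated by $f_1,\dots,f_n$ under composition of maps $\mathbb{R}\to\mathbb{R}$.
   Formalization: The affine maps $f_i$ act on ℚ rather than on ℝ, so equality of their compositions is pointwise equality at every rational point. -}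

module Defs where

open import Data.Nat as ℕ using (ℕ; zero; suc; _<_)
open import Data.Integer using (+_)
open import Data.Rational as ℚ using (ℚ; 0ℚ; _+_; _*_; _/_)
open import Data.Fin using (Fin; zero; suc)
open import Data.List using (List; []; _∷_)
open import Data.List.NonEmpty using (List⁺; _∷_)
open import Function using (_∘_; id)

affine : ℕ → ℚ → ℚ → ℚ
affine a b x = (+ a / 1) * x + b

sumFin : (n : ℕ) → (Fin n → ℚ) → ℚ
sumFin zero    g = 0ℚ
sumFin (suc n) g = g zero + sumFin n (g ∘ suc)

recip : (m : ℕ) → 0 < m → ℚ
recip m p = (+ 1 / m) {{ℕ.>-nonZero p}}

composeL : {A : Set} → List (A → A) → A → A
composeL []       = id
composeL (f ∷ fs) = f ∘ composeL fs

word : {n : ℕ} → (Fin n → ℚ → ℚ) → List⁺ (Fin n) → ℚ → ℚ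
word f (i ∷ is) = f i ∘ composeL (Data.List.map f is)

-- If some aᵢ = 1, then fᵢ is the translation by bᵢ and fⱼ ∘ fᵢ = fᵢ^aⱼ ∘ fⱼ for any j ≠ i.
-- Otherwise every aᵢ ≥ 2. With D a common denominator of the bᵢ and β large, h(x) = D x − β conjugates
-- fᵢ to gᵢ(y) = aᵢ y + dᵢ with natural dᵢ satisfying dᵢ + γ ≤ γ aᵢ (γ = 2β + 1). A word w then acts by
-- y ↦ A_w y + N_w with natural N_w < γ A_w, and for |w| ≤ k the slope A_w is one of at most (k + 1)ⁿ
-- products a₁^e₁ ⋯ aₙ^eₙ. Give each word of length k the weight Q^k / A_w, where Q = a₁ ⋯ aₙ: the total
-- weight is (Σᵢ Q / aᵢ)^k, whereas words with pairwise distinct (A_w, N_w) carry at most (k + 1)ⁿ γ Q^k.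
-- Since Σᵢ Q / aᵢ ≥ Q + 1, exponential growth wins for large k, so two distinct words of length k share
-- (A_w, N_w) and hence act identically.

module Submission where

open import Defs
open import Data.Nat using (ℕ; zero; suc; _+_; _*_; _^_; _∸_; _≤_; _<_; z≤n; s≤s; NonZero; >-nonZero)
open import Data.Nat.Properties
open import Data.Nat.DivMod using (_/_; m/n*n≤m; m*n/n≡m)
open import Data.Nat.Divisibility using (_∣_; divides; quotient; m∣n⇒n≡m*quotient)
open import Data.Nat.ListAction using (sum; product)
open import Data.Nat.ListAction.Properties using (sum-++; sum-↭; ∈⇒∣product)
open import Data.Nat.Solver renaming (module +-*-Solver to ℕ-Solver)
open import Data.Integer as ℤ using (ℤ)
import Data.Integer.Properties as ℤ
open import Data.Rational using (ℚ; 1ℚ) renaming (_<_ to _<ℚ_)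
import Data.Rational as ℚ
import Data.Rational.Properties as ℚ
open import Data.Rational.Solver renaming (module +-*-Solver to ℚ-Solver)
import Data.Rational.Unnormalised as ℚᵘ
import Data.Rational.Unnormalised.Properties as ℚᵘ
open import Data.Fin using (Fin; zero; suc)
import Data.Fin.Properties as Fin
open import Data.List using (List; []; _∷_; [_]; _++_; replicate; map; length; concatMap; cartesianProductWith; upTo; allFin)
open import Data.List.Properties using (map-++; map-∘; map-cong-local; map-tabulate; length-map; length-++; length-upTo; ∷-injective)
open import Data.List.NonEmpty as List⁺ using (List⁺; _∷_; toList)
open import Data.List.Membership.Propositional using (_∈_; find; lose)
open import Data.List.Membership.Propositional.Properties
  using ( ∈-allFin; ∈-map⁺; ∈-map⁻; ∈-∃++; ∈-++⁻; ∈-++⁺ˡ; ∈-++⁺ʳ; ∈-concatMap⁺; ∈-upTo⁺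
        ; ∈-cartesianProductWith⁺; ∈-cartesianProductWith⁻)
open import Data.List.Relation.Binary.Subset.Propositional using (_⊆_)
open import Data.List.Relation.Binary.Permutation.Propositional using (↭-sym)
open import Data.List.Relation.Binary.Permutation.Propositional.Properties using (shift) renaming (map⁺ to ↭-map⁺)
open import Data.List.Relation.Unary.All as All using (All; []; _∷_)
open import Data.List.Relation.Unary.All.Properties using (¬Any⇒All¬) renaming (map⁺ to All-map⁺)
open import Data.List.Relation.Unary.Any using (here; there; any?)
open import Data.List.Relation.Unary.AllPairs using ([]; _∷_)
open import Data.List.Relation.Unary.Unique.Propositional using (Unique)
open import Data.List.Relation.Unary.Unique.Propositional.Properties using (cartesianProductWith⁺; allFin⁺)
open import Data.Product using (Σ; _×_; _,_; proj₁; proj₂; ∃-syntax)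
import Data.Product.Properties as Product
open import Data.Sum using (_⊎_; inj₁; inj₂)
open import Data.Empty using (⊥-elim)
open import Function using (_∘_)
open import Relation.Binary.Definitions using (DecidableEquality)
open import Relation.Binary.PropositionalEquality
  using (_≡_; _≢_; refl; sym; trans; cong; cong₂; subst; subst₂; module ≡-Reasoning)
open import Relation.Nullary using (yes; no)

private variable A B C : Set

-- Exponential against polynomial growth

bernoulli : ∀ P j → P ^ j * (P + j) ≤ P * suc P ^ j
bernoulli P zero = ≤-reflexive (trans (*-identityˡ (P + 0)) (trans (+-identityʳ P) (sym (*-identityʳ P))))
bernoulli P (suc j) = begin
  P ^ suc j * (P + suc j)
    ≡⟨ solve 3 (λ p q j → (p :* q) :* (p :+ (con 1 :+ j)) := p :* (q :* (p :+ j)) :+ p :* q) refl P (P ^ j) j ⟩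
  P * (P ^ j * (P + j)) + P * P ^ j
    ≤⟨ +-mono-≤ (*-monoʳ-≤ P (bernoulli P j)) (*-monoʳ-≤ P (^-monoˡ-≤ j (n≤1+n P))) ⟩
  P * (P * suc P ^ j) + P * suc P ^ j
    ≡⟨ solve 2 (λ p r → p :* (p :* r) :+ p :* r := p :* ((con 1 :+ p) :* r)) refl P (suc P ^ j) ⟩
  P * suc P ^ suc j
    ∎
  where
  open ≤-Reasoning
  open ℕ-Solver

^-distribʳ-* : ∀ m n o → (m * n) ^ o ≡ m ^ o * n ^ o
^-distribʳ-* m n zero = refl
^-distribʳ-* m n (suc o) = trans (cong (m * n *_) (^-distribʳ-* m n o))
  (solve 4 (λ m n x y → (m :* n) :* (x :* y) := (m :* x) :* (n :* y)) refl m n (m ^ o) (n ^ o))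
  where open ℕ-Solver

bernoulli-^ : ∀ P j d → P ^ (j * d) * j ^ d ≤ P ^ d * suc P ^ (j * d)
bernoulli-^ P j d = begin
  P ^ (j * d) * j ^ d        ≡⟨ cong (_* j ^ d) (^-*-assoc P j d) ⟨
  (P ^ j) ^ d * j ^ d        ≡⟨ ^-distribʳ-* (P ^ j) j d ⟨
  (P ^ j * j) ^ d            ≤⟨ ^-monoˡ-≤ d (≤-trans (*-monoʳ-≤ (P ^ j) (m≤n+m j P)) (bernoulli P j)) ⟩
  (P * suc P ^ j) ^ d        ≡⟨ ^-distribʳ-* P (suc P ^ j) d ⟩
  P ^ d * (suc P ^ j) ^ d    ≡⟨ cong (P ^ d *_) (^-*-assoc (suc P) j d) ⟩
  P ^ d * suc P ^ (j * d)    ∎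
  where open ≤-Reasoning

exponential-beats-polynomial : ∀ P c m → 1 ≤ P → ∃[ k ] 1 ≤ k × c * suc k ^ m * P ^ k < suc P ^ k
exponential-beats-polynomial P c m 1≤P = k , 1≤k , <-≤-trans c·X<1+c·X 1+c·X≤
  where
  -- Bernoulli gives (1 + 1/P)^j ≥ j/P, so (1 + 1/P)^(j d) ≥ (j/P)^d, which beats (c + 1) (j d + 1)^m
  -- as soon as j ≥ (c + 1) P^d (d + 1)^m.
  d j k : ℕ
  d = suc m
  j = suc c * P ^ d * suc d ^ m
  k = j * d
  instance
    P≢0 : NonZero P
    P≢0 = >-nonZero 1≤P
    P^d≢0 : NonZero (P ^ d)
    P^d≢0 = m^n≢0 P d
  1≤j : 1 ≤ j
  1≤j = *-mono-≤ {1} {suc c * P ^ d} (*-mono-≤ {1} {suc c} (s≤s z≤n) (m^n>0 P d)) (m^n>0 (suc d) m)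
  1≤k : 1 ≤ k
  1≤k = *-mono-≤ 1≤j (s≤s z≤n)
  1+k≤ : suc k ≤ j * suc d
  1+k≤ = ≤-trans (+-monoˡ-≤ k 1≤j) (≤-reflexive (sym (*-suc j d)))
  X : ℕ
  X = suc k ^ m * P ^ k
  c·X<1+c·X : c * suc k ^ m * P ^ k < suc c * suc k ^ m * P ^ k
  c·X<1+c·X = begin-strict
    c * suc k ^ m * P ^ k   ≡⟨ *-assoc c (suc k ^ m) (P ^ k) ⟩
    c * X                   <⟨ m<n+m (c * X) (*-mono-≤ {1} {suc k ^ m} (m^n>0 (suc k) m) (m^n>0 P k)) ⟩
    X + c * X               ≡⟨ *-assoc (suc c) (suc k ^ m) (P ^ k) ⟨
    suc c * suc k ^ m * P ^ k ∎
    where open ≤-Reasoning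
  1+c·X≤ : suc c * suc k ^ m * P ^ k ≤ suc P ^ k
  1+c·X≤ = *-cancelʳ-≤ _ _ (P ^ d) (begin
    suc c * suc k ^ m * P ^ k * P ^ d
      ≤⟨ *-monoˡ-≤ (P ^ d) (*-monoˡ-≤ (P ^ k) (*-monoʳ-≤ (suc c) (^-monoˡ-≤ m 1+k≤))) ⟩
    suc c * (j * suc d) ^ m * P ^ k * P ^ d
      ≡⟨ cong (λ z → suc c * z * P ^ k * P ^ d) (^-distribʳ-* j (suc d) m) ⟩
    suc c * (j ^ m * suc d ^ m) * P ^ k * P ^ d
      ≡⟨ solve 5 (λ c x y pk pd → c :* (x :* y) :* pk :* pd := pk :* ((c :* pd :* y) :* x)) refl
           (suc c) (j ^ m) (suc d ^ m) (P ^ k) (P ^ d) ⟩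
    P ^ k * j ^ d
      ≤⟨ bernoulli-^ P j d ⟩
    P ^ d * suc P ^ k
      ≡⟨ *-comm (P ^ d) _ ⟩
    suc P ^ k * P ^ d
      ∎)
    where
    open ≤-Reasoning
    open ℕ-Solver

sum-map-≤ : (ψ : A → ℕ) {M : ℕ} → (∀ x → ψ x ≤ M) → ∀ xs → sum (map ψ xs) ≤ length xs * M
sum-map-≤ ψ ψ≤M [] = z≤n
sum-map-≤ ψ ψ≤M (x ∷ xs) = +-mono-≤ (ψ≤M x) (sum-map-≤ ψ ψ≤M xs)

sum-map-concatMap-≤ : (ψ : B → ℕ) (f : A → List B) {M : ℕ} →
  (∀ x → sum (map ψ (f x)) ≤ M) → ∀ xs → sum (map ψ (concatMap f xs)) ≤ length xs * M
sum-map-concatMap-≤ ψ f fx≤M [] = z≤n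
sum-map-concatMap-≤ ψ f {M} fx≤M (x ∷ xs) = begin
  sum (map ψ (f x ++ concatMap f xs))               ≡⟨ cong sum (map-++ ψ (f x) _) ⟩
  sum (map ψ (f x) ++ map ψ (concatMap f xs))       ≡⟨ sum-++ (map ψ (f x)) _ ⟩
  sum (map ψ (f x)) + sum (map ψ (concatMap f xs))  ≤⟨ +-mono-≤ (fx≤M x) (sum-map-concatMap-≤ ψ f fx≤M xs) ⟩
  M + length xs * M                                 ∎
  where open ≤-Reasoning

sum-map-*ˡ : (k : ℕ) (ψ : A → ℕ) → ∀ xs → sum (map (λ x → k * ψ x) xs) ≡ k * sum (map ψ xs)
sum-map-*ˡ k ψ [] = sym (*-zeroʳ k)
sum-map-*ˡ k ψ (x ∷ xs) = trans (cong (k * ψ x +_) (sum-map-*ˡ k ψ xs)) (sym (*-distribˡ-+ k (ψ x) _))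

sum-map-⊆ : (ψ : A → ℕ) {xs ys : List A} → Unique xs → xs ⊆ ys → sum (map ψ xs) ≤ sum (map ψ ys)
sum-map-⊆ ψ [] _ = z≤n
sum-map-⊆ ψ {x ∷ xs} (x∉xs ∷ xs!) xs⊆ys with ys₁ , ys₂ , refl ← ∈-∃++ (xs⊆ys (here refl)) = begin
  ψ x + sum (map ψ xs)                  ≤⟨ +-monoʳ-≤ (ψ x) (sum-map-⊆ ψ xs! xs⊆ys₁++ys₂) ⟩
  ψ x + sum (map ψ (ys₁ ++ ys₂))        ≡⟨ sum-↭ (↭-map⁺ ψ (↭-sym (shift x ys₁ ys₂))) ⟩
  sum (map ψ (ys₁ ++ [ x ] ++ ys₂))     ∎
  where
  open ≤-Reasoning
  xs⊆ys₁++ys₂ : xs ⊆ ys₁ ++ ys₂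
  xs⊆ys₁++ys₂ y∈xs with ∈-++⁻ ys₁ (xs⊆ys (there y∈xs))
  ... | inj₁ y∈ys₁ = ∈-++⁺ˡ y∈ys₁
  ... | inj₂ (here refl) = ⊥-elim (All.lookup x∉xs y∈xs refl)
  ... | inj₂ (there y∈ys₂) = ∈-++⁺ʳ ys₁ y∈ys₂

∈⇒≤sum : ∀ {m ms} → m ∈ ms → m ≤ sum ms
∈⇒≤sum (here refl) = m≤m+n _ _
∈⇒≤sum {ms = n ∷ _} (there m∈ms) = ≤-trans (∈⇒≤sum m∈ms) (m≤n+m _ n)

1≤product : ∀ {ms} → All (1 ≤_) ms → 1 ≤ product ms
1≤product [] = ≤-refl
1≤product (1≤m ∷ 1≤ms) = *-mono-≤ 1≤m (1≤product 1≤ms)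

module _ (_≟_ : DecidableEquality B) (key : A → B) where

  unique-or-collision : ∀ {xs} → Unique xs →
    Unique (map key xs) ⊎ ∃[ x ] ∃[ y ] x ∈ xs × y ∈ xs × x ≢ y × key x ≡ key y
  unique-or-collision [] = inj₁ []
  unique-or-collision {x ∷ xs} (x∉xs ∷ xs!) with any? (λ y → key x ≟ key y) xs
  ... | yes p = let y , y∈xs , kx≡ky = find p in
    inj₂ (x , y , here refl , there y∈xs , All.lookup x∉xs y∈xs , kx≡ky)
  ... | no ¬p with unique-or-collision xs!
  ...   | inj₁ keys! = inj₁ (All-map⁺ (¬Any⇒All¬ xs ¬p) ∷ keys!)
  ...   | inj₂ (y , z , y∈xs , z∈xs , y≢z , ky≡kz) = inj₂ (y , z , there y∈xs , there z∈xs , y≢z , ky≡kz)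

length-cartesianProductWith : (f : A → B → C) → ∀ xs ys →
  length (cartesianProductWith f xs ys) ≡ length xs * length ys
length-cartesianProductWith f [] ys = refl
length-cartesianProductWith f (x ∷ xs) ys = begin
  length (map (f x) ys ++ cartesianProductWith f xs ys)
    ≡⟨ length-++ (map (f x) ys) ⟩
  length (map (f x) ys) + length (cartesianProductWith f xs ys)
    ≡⟨ cong₂ _+_ (length-map (f x) ys) (length-cartesianProductWith f xs ys) ⟩
  length ys + length xs * length ys
    ∎
  where open ≡-Reasoning

-- Words, slopes and weights

words : ∀ n → ℕ → List (List (Fin n))
words n zero = [ [] ]
words n (suc k) = cartesianProductWith _∷_ (allFin n) (words n k)

words-unique : ∀ n k → Unique (words n k)
words-unique n zero = [] ∷ []
words-unique n (suc k) = cartesianProductWith⁺ _∷_ ∷-injective (allFin⁺ n) (words-unique n k)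

∈-words⁻ : ∀ {n} k {w} → w ∈ words n k → length w ≡ k
∈-words⁻ zero (here refl) = refl
∈-words⁻ {n} (suc k) w∈ with _ , _ , _ , v∈ , refl ← ∈-cartesianProductWith⁻ _∷_ (allFin n) (words n k) w∈ =
  cong suc (∈-words⁻ k v∈)

sum-product-cartesianProduct∷ : {A : Set} (c : A → ℕ) → ∀ xs ws →
  sum (map (product ∘ map c) (cartesianProductWith _∷_ xs ws)) ≡ sum (map c xs) * sum (map (product ∘ map c) ws)
sum-product-cartesianProduct∷ c [] ws = refl
sum-product-cartesianProduct∷ {A} c (x ∷ xs) ws = begin
  sum (map weight (map (x ∷_) ws ++ cartesianProductWith _∷_ xs ws))
    ≡⟨ cong sum (map-++ weight (map (x ∷_) ws) _) ⟩
  sum (map weight (map (x ∷_) ws) ++ map weight (cartesianProductWith _∷_ xs ws))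
    ≡⟨ sum-++ (map weight (map (x ∷_) ws)) _ ⟩
  sum (map weight (map (x ∷_) ws)) + sum (map weight (cartesianProductWith _∷_ xs ws))
    ≡⟨ cong₂ _+_ (cong sum (sym (map-∘ ws))) (sum-product-cartesianProduct∷ c xs ws) ⟩
  sum (map (λ w → c x * weight w) ws) + sum (map c xs) * sum (map weight ws)
    ≡⟨ cong (_+ sum (map c xs) * sum (map weight ws)) (sum-map-*ˡ (c x) weight ws) ⟩
  c x * sum (map weight ws) + sum (map c xs) * sum (map weight ws)
    ≡⟨ *-distribʳ-+ (sum (map weight ws)) (c x) _ ⟨
  (c x + sum (map c xs)) * sum (map weight ws)
    ∎
  where
  open ≡-Reasoning
  weight : List A → ℕ
  weight = product ∘ map c

sum-product-words : ∀ n (c : Fin n → ℕ) k → sum (map (product ∘ map c) (words n k)) ≡ sum (map c (allFin n)) ^ k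
sum-product-words n c zero = refl
sum-product-words n c (suc k) = trans (sum-product-cartesianProduct∷ c (allFin n) (words n k))
  (cong (sum (map c (allFin n)) *_) (sum-product-words n c k))

zeros : ∀ {n} → List (Fin (suc n)) → ℕ
zeros [] = 0
zeros (zero ∷ w) = suc (zeros w)
zeros (suc _ ∷ w) = zeros w

nonzeros : ∀ {n} → List (Fin (suc n)) → List (Fin n)
nonzeros [] = []
nonzeros (zero ∷ w) = nonzeros w
nonzeros (suc i ∷ w) = i ∷ nonzeros w

length-zeros-nonzeros : ∀ {n} (w : List (Fin (suc n))) → zeros w + length (nonzeros w) ≡ length w
length-zeros-nonzeros [] = refl
length-zeros-nonzeros (zero ∷ w) = cong suc (length-zeros-nonzeros w)
length-zeros-nonzeros (suc _ ∷ w) = trans (+-suc (zeros w) _) (cong suc (length-zeros-nonzeros w))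

product-zeros-nonzeros : ∀ {n} (a : Fin (suc n) → ℕ) w →
  product (map a w) ≡ a zero ^ zeros w * product (map (a ∘ suc) (nonzeros w))
product-zeros-nonzeros a [] = refl
product-zeros-nonzeros a (zero ∷ w) =
  trans (cong (a zero *_) (product-zeros-nonzeros a w)) (sym (*-assoc (a zero) _ _))
product-zeros-nonzeros a (suc i ∷ w) =
  trans (cong (a (suc i) *_) (product-zeros-nonzeros a w))
    (solve 3 (λ x y z → x :* (y :* z) := y :* (x :* z)) refl (a (suc i)) (a zero ^ zeros w) _)
  where open ℕ-Solver

slopes : ∀ {n} → (Fin n → ℕ) → ℕ → List ℕ
slopes {zero} a k = [ 1 ]
slopes {suc n} a k = cartesianProductWith (λ j s → a zero ^ j * s) (upTo (suc k)) (slopes (a ∘ suc) k)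

length-slopes : ∀ {n} (a : Fin n → ℕ) k → length (slopes a k) ≡ suc k ^ n
length-slopes {zero} a k = refl
length-slopes {suc n} a k = trans (length-cartesianProductWith (λ j s → a zero ^ j * s) (upTo (suc k)) (slopes (a ∘ suc) k))
  (cong₂ _*_ (length-upTo (suc k)) (length-slopes (a ∘ suc) k))

∈-slopes : ∀ {n} (a : Fin n → ℕ) {k} w → length w ≤ k → product (map a w) ∈ slopes a k
∈-slopes {zero} a [] _ = here refl
∈-slopes {suc n} a {k} w |w|≤k rewrite product-zeros-nonzeros a w =
  ∈-cartesianProductWith⁺ (λ j s → a zero ^ j * s)
    (∈-upTo⁺ (s≤s (≤-trans (m≤m+n (zeros w) _) split≤k)))
    (∈-slopes (a ∘ suc) (nonzeros w) (≤-trans (m≤n+m _ (zeros w)) split≤k))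
  where
  split≤k : zeros w + length (nonzeros w) ≤ k
  split≤k = ≤-trans (≤-reflexive (length-zeros-nonzeros w)) |w|≤k

pairsBelow : ℕ → List ℕ → List (ℕ × ℕ)
pairsBelow γ = concatMap (λ s → map (s ,_) (upTo (γ * s)))

∈-pairsBelow : ∀ γ {S s m} → s ∈ S → m < γ * s → (s , m) ∈ pairsBelow γ S
∈-pairsBelow γ s∈S m<γs = ∈-concatMap⁺ _ (lose s∈S (∈-map⁺ (_ ,_) (∈-upTo⁺ m<γs)))

-- Q / s, with the junk value 0 at s = 0
share : ℕ → ℕ → ℕ
share Q zero = 0
share Q (suc s) = Q / suc s

*-share-≤ : ∀ Q s → s * share Q s ≤ Q
*-share-≤ Q zero = z≤n
*-share-≤ Q (suc s) = ≤-trans (≤-reflexive (*-comm (suc s) _)) (m/n*n≤m Q (suc s))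

*≡⇒≡share : ∀ Q s {c} → NonZero s → c * s ≡ Q → c ≡ share Q s
*≡⇒≡share _ (suc s) {c} _ refl = sym (m*n/n≡m c (suc s))

sum-share-pairsBelow : ∀ Q γ S → sum (map (share Q ∘ proj₁) (pairsBelow γ S)) ≤ length S * (γ * Q)
sum-share-pairsBelow Q γ = sum-map-concatMap-≤ (share Q ∘ proj₁) _ row≤
  where
  row≤ : ∀ s → sum (map (share Q ∘ proj₁) (map (s ,_) (upTo (γ * s)))) ≤ γ * Q
  row≤ s = begin
    sum (map (share Q ∘ proj₁) (map (s ,_) (upTo (γ * s)))) ≡⟨ cong sum (map-∘ (upTo (γ * s))) ⟨
    sum (map (λ _ → share Q s) (upTo (γ * s)))              ≤⟨ sum-map-≤ (λ _ → share Q s) (λ _ → ≤-refl) (upTo (γ * s)) ⟩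
    length (upTo (γ * s)) * share Q s                       ≡⟨ cong (_* share Q s) (length-upTo (γ * s)) ⟩
    γ * s * share Q s                                       ≡⟨ *-assoc γ s _ ⟩
    γ * (s * share Q s)                                     ≤⟨ *-monoʳ-≤ γ (*-share-≤ Q s) ⟩
    γ * Q                                                   ∎
    where open ≤-Reasoning

product-*-product : {a c : A → ℕ} {Q : ℕ} → (∀ i → a i * c i ≡ Q) →
  ∀ w → product (map c w) * product (map a w) ≡ Q ^ length w
product-*-product a*c≡Q [] = refl
product-*-product {a = a} {c} {Q} a*c≡Q (i ∷ w) = begin
  c i * product (map c w) * (a i * product (map a w))
    ≡⟨ solve 4 (λ x y z u → x :* z :* (y :* u) := y :* x :* (z :* u)) refl (c i) (a i) (product (map c w)) (product (map a w)) ⟩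
  a i * c i * (product (map c w) * product (map a w))
    ≡⟨ cong₂ _*_ (a*c≡Q i) (product-*-product a*c≡Q w) ⟩
  Q * Q ^ length w
    ∎
  where
  open ≡-Reasoning
  open ℕ-Solver

-- Affine maps with natural coefficients

Collision : ∀ {n} → (List (Fin n) → List (Fin n) → Set) → Set
Collision {n} _≈_ = Σ (List⁺ (Fin n)) λ v → Σ (List⁺ (Fin n)) λ w → v ≢ w × toList v ≈ toList w

collision-of-nonempty : ∀ {n} {_≈_ : List (Fin n) → List (Fin n) → Set} {v w} →
  1 ≤ length v → 1 ≤ length w → v ≢ w → v ≈ w → Collision _≈_
collision-of-nonempty {v = i ∷ v} {j ∷ w} _ _ v≢w v≈w = i ∷ v , j ∷ w , (λ eq → v≢w (cong toList eq)) , v≈w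

Collision-map : ∀ {n} {R S : List (Fin n) → List (Fin n) → Set} → (∀ v w → R v w → S v w) → Collision R → Collision S
Collision-map R⇒S (v , w , v≢w , r) = v , w , v≢w , R⇒S (toList v) (toList w) r

module NaturalAffine {n} (a d : Fin n → ℕ) where

  slope : List (Fin n) → ℕ
  slope w = product (map a w)

  intercept : List (Fin n) → ℕ
  intercept [] = 0
  intercept (i ∷ w) = d i + a i * intercept w

  key : List (Fin n) → ℕ × ℕ
  key w = slope w , intercept w

  module _ {γ} (d+γ≤γ*a : ∀ i → d i + γ ≤ γ * a i) where

    intercept+γ≤γ*slope : ∀ w → intercept w + γ ≤ γ * slope w
    intercept+γ≤γ*slope [] = ≤-reflexive (sym (*-identityʳ γ))
    intercept+γ≤γ*slope (i ∷ w) = begin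
      d i + a i * intercept w + γ    ≡⟨ solve 4 (λ d x y g → d :+ x :* y :+ g := (d :+ g) :+ x :* y) refl (d i) (a i) (intercept w) γ ⟩
      d i + γ + a i * intercept w    ≤⟨ +-monoˡ-≤ _ (d+γ≤γ*a i) ⟩
      γ * a i + a i * intercept w    ≡⟨ solve 3 (λ g x y → g :* x :+ x :* y := x :* (y :+ g)) refl γ (a i) (intercept w) ⟩
      a i * (intercept w + γ)        ≤⟨ *-monoʳ-≤ (a i) (intercept+γ≤γ*slope w) ⟩
      a i * (γ * slope w)            ≡⟨ solve 3 (λ x g y → x :* (g :* y) := g :* (x :* y)) refl (a i) γ (slope w) ⟩
      γ * slope (i ∷ w)              ∎
      where
      open ≤-Reasoning
      open ℕ-Solver

    module _ (1≤γ : 1 ≤ γ) where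

      intercept<γ*slope : ∀ w → intercept w < γ * slope w
      intercept<γ*slope w = ≤-trans (≤-reflexive (+-comm 1 (intercept w)))
        (≤-trans (+-monoʳ-≤ (intercept w) 1≤γ) (intercept+γ≤γ*slope w))

      slope-nonZero : ∀ w → NonZero (slope w)
      slope-nonZero w = >-nonZero (*-cancelˡ-≤ γ {{>-nonZero 1≤γ}}
        (≤-trans (≤-reflexive (*-identityʳ γ)) (≤-trans (m≤n+m γ (intercept w)) (intercept+γ≤γ*slope w))))

      module _ (c : Fin n → ℕ) {Q} (a*c≡Q : ∀ i → a i * c i ≡ Q) where

        weight≡share : ∀ k {w} → w ∈ words n k → product (map c w) ≡ share (Q ^ k) (slope w)
        weight≡share k {w} w∈ = *≡⇒≡share (Q ^ k) (slope w) (slope-nonZero w)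
          (trans (product-*-product a*c≡Q w) (cong (Q ^_) (∈-words⁻ k w∈)))

        keys⊆pairsBelow : ∀ k → map key (words n k) ⊆ pairsBelow γ (slopes a k)
        keys⊆pairsBelow k x∈ with w , w∈ , refl ← ∈-map⁻ key x∈ =
          ∈-pairsBelow γ (∈-slopes a w (≤-reflexive (∈-words⁻ k w∈))) (intercept<γ*slope w)

        sum-^-≤ : ∀ k → Unique (map key (words n k)) → sum (map c (allFin n)) ^ k ≤ suc k ^ n * (γ * Q ^ k)
        sum-^-≤ k keys! = begin
          sum (map c (allFin n)) ^ k
            ≡⟨ sum-product-words n c k ⟨
          sum (map (product ∘ map c) (words n k))
            ≡⟨ cong sum (map-cong-local (All.tabulate (weight≡share k))) ⟩
          sum (map (share (Q ^ k) ∘ proj₁ ∘ key) (words n k))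
            ≡⟨ cong sum (map-∘ (words n k)) ⟩
          sum (map (share (Q ^ k) ∘ proj₁) (map key (words n k)))
            ≤⟨ sum-map-⊆ (share (Q ^ k) ∘ proj₁) keys! (keys⊆pairsBelow k) ⟩
          sum (map (share (Q ^ k) ∘ proj₁) (pairsBelow γ (slopes a k)))
            ≤⟨ sum-share-pairsBelow (Q ^ k) γ (slopes a k) ⟩
          length (slopes a k) * (γ * Q ^ k)
            ≡⟨ cong (_* (γ * Q ^ k)) (length-slopes a k) ⟩
          suc k ^ n * (γ * Q ^ k)
            ∎
          where open ≤-Reasoning

        collision : 1 ≤ Q → Q < sum (map c (allFin n)) → Collision (λ v w → key v ≡ key w)
        collision 1≤Q Q<sum
          with k , 1≤k , poly<exp ← exponential-beats-polynomial Q γ n 1≤Q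
          with unique-or-collision (Product.≡-dec _≟_ _≟_) key (words-unique n k)
        ... | inj₂ (v , w , v∈ , w∈ , v≢w , kv≡kw) =
          collision-of-nonempty {_≈_ = λ v w → key v ≡ key w} (nonempty v∈) (nonempty w∈) v≢w kv≡kw
          where
          nonempty : ∀ {w} → w ∈ words n k → 1 ≤ length w
          nonempty w∈ = ≤-trans 1≤k (≤-reflexive (sym (∈-words⁻ k w∈)))
        ... | inj₁ keys! = ⊥-elim (<-irrefl refl (begin-strict
          suc Q ^ k                     ≤⟨ ^-monoˡ-≤ k Q<sum ⟩
          sum (map c (allFin n)) ^ k    ≤⟨ sum-^-≤ k keys! ⟩
          suc k ^ n * (γ * Q ^ k)       ≡⟨ solve 3 (λ p g q → p :* (g :* q) := g :* p :* q) refl (suc k ^ n) γ (Q ^ k) ⟩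
          γ * suc k ^ n * Q ^ k         <⟨ poly<exp ⟩
          suc Q ^ k                     ∎))
          where
          open ≤-Reasoning
          open ℕ-Solver

ι : ℤ → ℚ
ι z = z ℚ./ 1

fromℚᵘ-homo-+ : ∀ p q → ℚ.fromℚᵘ (p ℚᵘ.+ q) ≡ ℚ.fromℚᵘ p ℚ.+ ℚ.fromℚᵘ q
fromℚᵘ-homo-+ p q = ℚ.toℚᵘ-injective (ℚᵘ.≃-trans (ℚ.toℚᵘ-fromℚᵘ (p ℚᵘ.+ q)) (ℚᵘ.≃-sym
  (ℚᵘ.≃-trans (ℚ.toℚᵘ-homo-+ (ℚ.fromℚᵘ p) _) (ℚᵘ.+-cong (ℚ.toℚᵘ-fromℚᵘ p) (ℚ.toℚᵘ-fromℚᵘ q)))))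

fromℚᵘ-homo-* : ∀ p q → ℚ.fromℚᵘ (p ℚᵘ.* q) ≡ ℚ.fromℚᵘ p ℚ.* ℚ.fromℚᵘ q
fromℚᵘ-homo-* p q = ℚ.toℚᵘ-injective (ℚᵘ.≃-trans (ℚ.toℚᵘ-fromℚᵘ (p ℚᵘ.* q)) (ℚᵘ.≃-sym
  (ℚᵘ.≃-trans (ℚ.toℚᵘ-homo-* (ℚ.fromℚᵘ p) _) (ℚᵘ.*-cong (ℚ.toℚᵘ-fromℚᵘ p) (ℚ.toℚᵘ-fromℚᵘ q)))))

ι-homo-+ : ∀ x y → ι (x ℤ.+ y) ≡ ι x ℚ.+ ι y
ι-homo-+ x y = trans
  (ℚ.fromℚᵘ-cong {ℚᵘ.mkℚᵘ (x ℤ.+ y) 0} {ℚᵘ.mkℚᵘ x 0 ℚᵘ.+ ℚᵘ.mkℚᵘ y 0}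
    (ℚᵘ.*≡* (cong (ℤ._* ℤ.+ 1) (sym (cong₂ ℤ._+_ (ℤ.*-identityʳ x) (ℤ.*-identityʳ y))))))
  (fromℚᵘ-homo-+ (ℚᵘ.mkℚᵘ x 0) (ℚᵘ.mkℚᵘ y 0))

ι-homo-* : ∀ x y → ι (x ℤ.* y) ≡ ι x ℚ.* ι y
ι-homo-* x y = fromℚᵘ-homo-* (ℚᵘ.mkℚᵘ x 0) (ℚᵘ.mkℚᵘ y 0)

ι-cancel-< : ∀ {m n} → ι (ℤ.+ m) ℚ.< ι (ℤ.+ n) → m < n
ι-cancel-< {m} {n} ιm<ιn = ℤ.drop‿+<+ (subst₂ ℤ._<_ (ℤ.*-identityʳ (ℤ.+ m)) (ℤ.*-identityʳ (ℤ.+ n))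
  (ℚᵘ.drop-*<* (ℚᵘ.<-respʳ-≃ (ℚ.toℚᵘ-fromℚᵘ (ℚᵘ.mkℚᵘ (ℤ.+ n) 0))
    (ℚᵘ.<-respˡ-≃ (ℚ.toℚᵘ-fromℚᵘ (ℚᵘ.mkℚᵘ (ℤ.+ m) 0)) (ℚ.toℚᵘ-mono-< ιm<ιn)))))

ιₙ : ℕ → ℚ
ιₙ m = ι (ℤ.+ m)

ιₙ-homo-+ : ∀ m n → ιₙ (m + n) ≡ ιₙ m ℚ.+ ιₙ n
ιₙ-homo-+ m n = trans (cong ι (ℤ.pos-+ m n)) (ι-homo-+ (ℤ.+ m) (ℤ.+ n))

ιₙ-homo-* : ∀ m n → ιₙ (m * n) ≡ ιₙ m ℚ.* ιₙ n
ιₙ-homo-* m n = trans (cong ι (ℤ.pos-* m n)) (ι-homo-* (ℤ.+ m) (ℤ.+ n))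

ιₙ-positive : ∀ m → ℚ.Positive (ιₙ (suc m))
ιₙ-positive m = ℚ.normalize-pos (suc m) 1

ιₙ-nonZero : ∀ m → 1 ≤ m → ℚ.NonZero (ιₙ m)
ιₙ-nonZero (suc m) _ = ℚ.pos⇒nonZero (ιₙ (suc m)) {{ιₙ-positive m}}

recip-*-ιₙ : ∀ m (m>0 : 0 < m) q → recip m m>0 ℚ.* ιₙ (m * q) ≡ ιₙ q
recip-*-ιₙ (suc m) _ q = trans (sym (fromℚᵘ-homo-* (ℚᵘ.mkℚᵘ (ℤ.+ 1) m) (ℚᵘ.mkℚᵘ (ℤ.+ (suc m * q)) 0)))
  (ℚ.fromℚᵘ-cong {ℚᵘ.mkℚᵘ (ℤ.+ 1) m ℚᵘ.* ℚᵘ.mkℚᵘ (ℤ.+ (suc m * q)) 0} {ℚᵘ.mkℚᵘ (ℤ.+ q) 0}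
    (ℚᵘ.*≡* (trans (ℤ.*-identityʳ _) (trans (ℤ.*-identityˡ _)
    (trans (cong ℤ.+_ (trans (*-comm (suc m) q) (cong (q *_) (sym (*-identityʳ (suc m))))))
      (ℤ.pos-* q (suc m * 1)))))))

sumFin-*ʳ : ∀ n g r → sumFin n g ℚ.* r ≡ sumFin n (λ i → g i ℚ.* r)
sumFin-*ʳ zero g r = ℚ.*-zeroˡ r
sumFin-*ʳ (suc n) g r = trans (ℚ.*-distribʳ-+ r (g zero) _) (cong (g zero ℚ.* r ℚ.+_) (sumFin-*ʳ n (g ∘ suc) r))

sumFin-cong : ∀ n {g h : Fin n → ℚ} → (∀ i → g i ≡ h i) → sumFin n g ≡ sumFin n h
sumFin-cong zero g≡h = refl
sumFin-cong (suc n) g≡h = cong₂ ℚ._+_ (g≡h zero) (sumFin-cong n (g≡h ∘ suc))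

map-allFin-suc : ∀ {n} (c : Fin (suc n) → A) → map c (allFin (suc n)) ≡ c zero ∷ map (c ∘ suc) (allFin n)
map-allFin-suc {n = n} c = cong (c zero ∷_) (trans (map-tabulate suc c) (sym (map-tabulate (λ i → i) (c ∘ suc))))

sumFin-ιₙ : ∀ n (c : Fin n → ℕ) → sumFin n (ιₙ ∘ c) ≡ ιₙ (sum (map c (allFin n)))
sumFin-ιₙ zero c = refl
sumFin-ιₙ (suc n) c = begin
  ιₙ (c zero) ℚ.+ sumFin n (ιₙ ∘ c ∘ suc)           ≡⟨ cong (ιₙ (c zero) ℚ.+_) (sumFin-ιₙ n (c ∘ suc)) ⟩
  ιₙ (c zero) ℚ.+ ιₙ (sum (map (c ∘ suc) (allFin n))) ≡⟨ ιₙ-homo-+ (c zero) _ ⟨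
  ιₙ (sum (c zero ∷ map (c ∘ suc) (allFin n)))       ≡⟨ cong (ιₙ ∘ sum) (map-allFin-suc c) ⟨
  ιₙ (sum (map c (allFin (suc n))))                  ∎
  where open ≡-Reasoning

<-sum-of-cofactors : ∀ n (a : Fin n → ℕ) (a>0 : ∀ i → 0 < a i) {c : Fin n → ℕ} {Q} → 1 ≤ Q →
  (∀ i → a i * c i ≡ Q) → 1ℚ <ℚ sumFin n (λ i → recip (a i) (a>0 i)) → Q < sum (map c (allFin n))
<-sum-of-cofactors n a a>0 {c} {suc q} _ a*c≡Q 1<sum =
  ι-cancel-< (subst₂ ℚ._<_ (ℚ.*-identityˡ (ιₙ (suc q))) sum*Q≡ (ℚ.*-monoˡ-<-pos (ιₙ (suc q)) 1<sum))
  where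
  instance
    Q>0 : ℚ.Positive (ιₙ (suc q))
    Q>0 = ιₙ-positive q
  sum*Q≡ : sumFin n (λ i → recip (a i) (a>0 i)) ℚ.* ιₙ (suc q) ≡ ιₙ (sum (map c (allFin n)))
  sum*Q≡ = trans (sumFin-*ʳ n _ _) (trans (sumFin-cong n λ i →
      trans (cong (λ Q → recip (a i) (a>0 i) ℚ.* ιₙ Q) (sym (a*c≡Q i))) (recip-*-ιₙ (a i) (a>0 i) (c i)))
    (sumFin-ιₙ n c))

-- Conjugating the maps to ones with natural coefficients

denominator∣⇒*-integral : ∀ (b : ℚ) {D} → ℚ.↧ₙ b ∣ D → ∃[ e ] ιₙ D ℚ.* b ≡ ι e
denominator∣⇒*-integral b@(ℚ.mkℚ num den-1 _) (divides r refl) = num ℤ.* ℤ.+ r , (begin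
  ιₙ (r * den) ℚ.* b
    ≡⟨ cong (ιₙ (r * den) ℚ.*_) (ℚ.fromℚᵘ-toℚᵘ b) ⟨
  ιₙ (r * den) ℚ.* ℚ.fromℚᵘ (ℚ.toℚᵘ b)
    ≡⟨ fromℚᵘ-homo-* (ℚᵘ.mkℚᵘ (ℤ.+ (r * den)) 0) (ℚ.toℚᵘ b) ⟨
  ℚ.fromℚᵘ (ℚᵘ.mkℚᵘ (ℤ.+ (r * den)) 0 ℚᵘ.* ℚ.toℚᵘ b)
    ≡⟨ ℚ.fromℚᵘ-cong {ℚᵘ.mkℚᵘ (ℤ.+ (r * den)) 0 ℚᵘ.* ℚ.toℚᵘ b} {ℚᵘ.mkℚᵘ (num ℤ.* ℤ.+ r) 0}
         (ℚᵘ.*≡* cross) ⟩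
  ι (num ℤ.* ℤ.+ r)
    ∎)
  where
  open ≡-Reasoning
  den : ℕ
  den = suc den-1
  cross : ℤ.+ (r * den) ℤ.* num ℤ.* ℤ.+ 1 ≡ num ℤ.* ℤ.+ r ℤ.* ℤ.+ (1 * den)
  cross = trans (ℤ.*-identityʳ _) (trans (cong (ℤ._* num) (ℤ.pos-* r den)) (trans (ℤ.*-comm _ num)
    (trans (sym (ℤ.*-assoc num (ℤ.+ r) (ℤ.+ den))) (cong (λ z → num ℤ.* ℤ.+ r ℤ.* ℤ.+ z) (sym (*-identityˡ den))))))

shift-to-ℕ : ∀ (e : ℤ) a β → 2 ≤ a → ℤ.∣ e ∣ ≤ β → ∃[ d ] e ℤ.+ ℤ.+ (a * β) ≡ ℤ.+ (d + β) × d ≤ a * β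
shift-to-ℕ (ℤ.+ m) (suc (suc a-2)) β (s≤s (s≤s z≤n)) m≤β =
  m + suc a-2 * β , trans (sym (ℤ.pos-+ m _)) (cong ℤ.+_ (+-comm-middle m β _)) , +-monoˡ-≤ (suc a-2 * β) m≤β
  where
  +-comm-middle : ∀ x y z → x + (y + z) ≡ x + z + y
  +-comm-middle x y z = trans (cong (x +_) (+-comm y z)) (sym (+-assoc x z y))
shift-to-ℕ ℤ.-[1+ m ] (suc (suc a-2)) β (s≤s (s≤s z≤n)) 1+m≤β =
  suc a-2 * β ∸ suc m , eq , ≤-trans (m∸n≤m _ (suc m)) (m≤n+m _ β)
  where
  1+m≤ : suc m ≤ suc a-2 * β
  1+m≤ = ≤-trans 1+m≤β (m≤m+n β _)
  eq : ℤ.-[1+ m ] ℤ.+ ℤ.+ (β + suc a-2 * β) ≡ ℤ.+ (suc a-2 * β ∸ suc m + β)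
  eq = trans (ℤ.⊖-≥ (≤-trans 1+m≤ (m≤n+m _ β)))
    (cong ℤ.+_ (trans (+-∸-assoc β 1+m≤) (+-comm β _)))

≤a*β⇒+[1+2β]≤[1+2β]*a : ∀ {d} a β → 2 ≤ a → d ≤ a * β → d + suc (β + β) ≤ suc (β + β) * a
≤a*β⇒+[1+2β]≤[1+2β]*a {d} a β 2≤a d≤aβ = begin
  d + suc (β + β)         ≤⟨ +-monoˡ-≤ _ d≤aβ ⟩
  a * β + suc (β + β)     ≡⟨ solve 2 (λ a b → a :* b :+ (con 1 :+ (b :+ b)) := a :* b :+ (con 1 :+ con 2 :* b)) refl a β ⟩
  a * β + (1 + 2 * β)     ≤⟨ +-monoʳ-≤ (a * β) (+-mono-≤ (≤-trans (s≤s z≤n) 2≤a) (*-monoˡ-≤ β 2≤a)) ⟩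
  a * β + (a + a * β)     ≡⟨ solve 2 (λ a b → a :* b :+ (a :+ a :* b) := (con 1 :+ (b :+ b)) :* a) refl a β ⟩
  suc (β + β) * a         ∎
  where
  open ≤-Reasoning
  open ℕ-Solver

SameMap : ∀ {n} → (Fin n → A → A) → List (Fin n) → List (Fin n) → Set
SameMap f v w = ∀ x → composeL (map f v) x ≡ composeL (map f w) x

composeL-semiconj : {f : C → A → A} {g : C → B → B} (h : A → B) → (∀ i x → h (f i x) ≡ g i (h x)) →
  ∀ w x → h (composeL (map f w) x) ≡ composeL (map g w) (h x)
composeL-semiconj h h∘f≡g∘h [] x = refl
composeL-semiconj {g = g} h h∘f≡g∘h (i ∷ w) x =
  trans (h∘f≡g∘h i _) (cong (g i) (composeL-semiconj h h∘f≡g∘h w x))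

module _ {n} (a d : Fin n → ℕ) where
  open NaturalAffine a d

  composeL-affine : ∀ w y → composeL (map (λ i → affine (a i) (ιₙ (d i))) w) y ≡ ιₙ (slope w) ℚ.* y ℚ.+ ιₙ (intercept w)
  composeL-affine [] y = sym (trans (ℚ.+-identityʳ _) (ℚ.*-identityˡ y))
  composeL-affine (i ∷ w) y = begin
    ιₙ (a i) ℚ.* composeL (map (λ i → affine (a i) (ιₙ (d i))) w) y ℚ.+ ιₙ (d i)
      ≡⟨ cong (λ z → ιₙ (a i) ℚ.* z ℚ.+ ιₙ (d i)) (composeL-affine w y) ⟩
    ιₙ (a i) ℚ.* (ιₙ (slope w) ℚ.* y ℚ.+ ιₙ (intercept w)) ℚ.+ ιₙ (d i)
      ≡⟨ solve 5 (λ A S y N D → A :* (S :* y :+ N) :+ D := A :* S :* y :+ (D :+ A :* N)) refl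
           (ιₙ (a i)) (ιₙ (slope w)) y (ιₙ (intercept w)) (ιₙ (d i)) ⟩
    ιₙ (a i) ℚ.* ιₙ (slope w) ℚ.* y ℚ.+ (ιₙ (d i) ℚ.+ ιₙ (a i) ℚ.* ιₙ (intercept w))
      ≡⟨ cong₂ (λ S N → S ℚ.* y ℚ.+ N) (ιₙ-homo-* (a i) (slope w))
           (trans (ιₙ-homo-+ (d i) _) (cong (ιₙ (d i) ℚ.+_) (ιₙ-homo-* (a i) _))) ⟨
    ιₙ (slope (i ∷ w)) ℚ.* y ℚ.+ ιₙ (intercept (i ∷ w))
      ∎
    where
    open ≡-Reasoning
    open ℚ-Solver

  composeL-affine-cong : ∀ {v w} → key v ≡ key w → SameMap (λ i → affine (a i) (ιₙ (d i))) v w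
  composeL-affine-cong {v} {w} kv≡kw y = trans (composeL-affine v y) (trans
    (cong (λ k → ιₙ (proj₁ k) ℚ.* y ℚ.+ ιₙ (proj₂ k)) kv≡kw) (sym (composeL-affine w y)))

*-+-injective : (r : ℚ) .{{_ : ℚ.NonZero r}} → ∀ {q x y} → r ℚ.* x ℚ.+ q ≡ r ℚ.* y ℚ.+ q → x ≡ y
*-+-injective r {q} {x} {y} eq = begin
  x                                  ≡⟨ ℚ.*-identityˡ x ⟨
  1ℚ ℚ.* x                           ≡⟨ cong (ℚ._* x) (ℚ.*-inverseˡ r) ⟨
  ℚ.1/ r ℚ.* r ℚ.* x                 ≡⟨ solve 4 (λ u r x q → u :* r :* x := u :* (r :* x :+ q :- q)) refl (ℚ.1/ r) r x q ⟩
  ℚ.1/ r ℚ.* (r ℚ.* x ℚ.+ q ℚ.- q)   ≡⟨ cong (λ z → ℚ.1/ r ℚ.* (z ℚ.- q)) eq ⟩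
  ℚ.1/ r ℚ.* (r ℚ.* y ℚ.+ q ℚ.- q)   ≡⟨ solve 4 (λ u r y q → u :* (r :* y :+ q :- q) := u :* r :* y) refl (ℚ.1/ r) r y q ⟩
  ℚ.1/ r ℚ.* r ℚ.* y                 ≡⟨ cong (ℚ._* y) (ℚ.*-inverseˡ r) ⟩
  1ℚ ℚ.* y                           ≡⟨ ℚ.*-identityˡ y ⟩
  y                                  ∎
  where
  open ≡-Reasoning
  open ℚ-Solver

affine-semiconj : ∀ a b D β d → ιₙ D ℚ.* b ℚ.+ ιₙ a ℚ.* ιₙ β ≡ ιₙ d ℚ.+ ιₙ β →
  ∀ x → ιₙ D ℚ.* affine a b x ℚ.- ιₙ β ≡ affine a (ιₙ d) (ιₙ D ℚ.* x ℚ.- ιₙ β)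
affine-semiconj a b D β d Db+aβ≡d+β x = begin
  ιₙ D ℚ.* (ιₙ a ℚ.* x ℚ.+ b) ℚ.- ιₙ β
    ≡⟨ solve 5 (λ D a x b β → D :* (a :* x :+ b) :- β := a :* (D :* x :- β) :+ (D :* b :+ a :* β :- β))
         refl (ιₙ D) (ιₙ a) x b (ιₙ β) ⟩
  ιₙ a ℚ.* (ιₙ D ℚ.* x ℚ.- ιₙ β) ℚ.+ (ιₙ D ℚ.* b ℚ.+ ιₙ a ℚ.* ιₙ β ℚ.- ιₙ β)
    ≡⟨ cong (λ z → ιₙ a ℚ.* (ιₙ D ℚ.* x ℚ.- ιₙ β) ℚ.+ (z ℚ.- ιₙ β)) Db+aβ≡d+β ⟩
  ιₙ a ℚ.* (ιₙ D ℚ.* x ℚ.- ιₙ β) ℚ.+ (ιₙ d ℚ.+ ιₙ β ℚ.- ιₙ β)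
    ≡⟨ solve 4 (λ a y d β → a :* y :+ (d :+ β :- β) := a :* y :+ d) refl
         (ιₙ a) (ιₙ D ℚ.* x ℚ.- ιₙ β) (ιₙ d) (ιₙ β) ⟩
  ιₙ a ℚ.* (ιₙ D ℚ.* x ℚ.- ιₙ β) ℚ.+ ιₙ d
    ∎
  where
  open ≡-Reasoning
  open ℚ-Solver

module Conjugation {n} (a : Fin n → ℕ) (b : Fin n → ℚ) (2≤a : ∀ i → 2 ≤ a i) where

  D : ℕ
  D = product (map (ℚ.↧ₙ_ ∘ b) (allFin n))

  cleared : ∀ i → ∃[ e ] ιₙ D ℚ.* b i ≡ ι e
  cleared i = denominator∣⇒*-integral (b i) (∈⇒∣product (∈-map⁺ (ℚ.↧ₙ_ ∘ b) (∈-allFin i)))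

  e : Fin n → ℤ
  e i = proj₁ (cleared i)

  β : ℕ
  β = sum (map (ℤ.∣_∣ ∘ e) (allFin n))

  shifted : ∀ i → ∃[ d ] e i ℤ.+ ℤ.+ (a i * β) ≡ ℤ.+ (d + β) × d ≤ a i * β
  shifted i = shift-to-ℕ (e i) (a i) β (2≤a i) (∈⇒≤sum (∈-map⁺ (ℤ.∣_∣ ∘ e) (∈-allFin i)))

  d : Fin n → ℕ
  d i = proj₁ (shifted i)

  d+γ≤γ*a : ∀ i → d i + suc (β + β) ≤ suc (β + β) * a i
  d+γ≤γ*a i = ≤a*β⇒+[1+2β]≤[1+2β]*a (a i) β (2≤a i) (proj₂ (proj₂ (shifted i)))

  h : ℚ → ℚ
  h x = ιₙ D ℚ.* x ℚ.- ιₙ β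

  h-semiconj : ∀ i x → h (affine (a i) (b i) x) ≡ affine (a i) (ιₙ (d i)) (h x)
  h-semiconj i = affine-semiconj (a i) (b i) D β (d i) (begin
    ιₙ D ℚ.* b i ℚ.+ ιₙ (a i) ℚ.* ιₙ β  ≡⟨ cong₂ ℚ._+_ (proj₂ (cleared i)) (sym (ιₙ-homo-* (a i) β)) ⟩
    ι (e i) ℚ.+ ιₙ (a i * β)            ≡⟨ ι-homo-+ (e i) _ ⟨
    ι (e i ℤ.+ ℤ.+ (a i * β))           ≡⟨ cong ι (proj₁ (proj₂ (shifted i))) ⟩
    ιₙ (d i + β)                        ≡⟨ ιₙ-homo-+ (d i) β ⟩
    ιₙ (d i) ℚ.+ ιₙ β                   ∎)
    where open ≡-Reasoning

  h-injective : ∀ {x y} → h x ≡ h y → x ≡ y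
  h-injective = *-+-injective (ιₙ D) {{ιₙ-nonZero D (1≤product (All-map⁺ (All.universal (λ _ → s≤s z≤n) (allFin n))))}}

expanding-collision : ∀ n (a : Fin n → ℕ) (a>0 : ∀ i → 0 < a i) (b : Fin n → ℚ) → (∀ i → 2 ≤ a i) →
  1ℚ <ℚ sumFin n (λ i → recip (a i) (a>0 i)) → Collision (SameMap (λ i → affine (a i) (b i)))
expanding-collision n a a>0 b 2≤a 1<sum = Collision-map same-key⇒same-map key-collision
  where
  open Conjugation a b 2≤a
  open NaturalAffine a d
  Q : ℕ
  Q = product (map a (allFin n))
  1≤Q : 1 ≤ Q
  1≤Q = 1≤product (All-map⁺ (All.universal a>0 (allFin n)))
  a∣Q : ∀ i → a i ∣ Q
  a∣Q i = ∈⇒∣product (∈-map⁺ a (∈-allFin i))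
  a*cofactor≡Q : ∀ i → a i * quotient (a∣Q i) ≡ Q
  a*cofactor≡Q i = sym (m∣n⇒n≡m*quotient (a∣Q i))
  key-collision : Collision (λ v w → key v ≡ key w)
  key-collision = collision d+γ≤γ*a (s≤s z≤n) (λ i → quotient (a∣Q i)) a*cofactor≡Q 1≤Q
    (<-sum-of-cofactors n a a>0 1≤Q a*cofactor≡Q 1<sum)
  same-key⇒same-map : ∀ v w → key v ≡ key w → SameMap (λ i → affine (a i) (b i)) v w
  same-key⇒same-map v w kv≡kw x = h-injective (begin
    h (composeL (map (λ i → affine (a i) (b i)) v) x)       ≡⟨ composeL-semiconj h h-semiconj v x ⟩
    composeL (map (λ i → affine (a i) (ιₙ (d i))) v) (h x)  ≡⟨ composeL-affine-cong a d {v} {w} kv≡kw (h x) ⟩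
    composeL (map (λ i → affine (a i) (ιₙ (d i))) w) (h x)  ≡⟨ composeL-semiconj h h-semiconj w x ⟨
    h (composeL (map (λ i → affine (a i) (b i)) w) x)       ∎)
    where open ≡-Reasoning

composeL-replicate-translation : ∀ {n} (f : Fin n → ℚ → ℚ) {i t} → (∀ x → f i x ≡ x ℚ.+ t) →
  ∀ k w x → composeL (map f (replicate k i ++ w)) x ≡ composeL (map f w) x ℚ.+ ιₙ k ℚ.* t
composeL-replicate-translation f {t = t} fi≡+t zero w x =
  sym (trans (cong (composeL (map f w) x ℚ.+_) (ℚ.*-zeroˡ t)) (ℚ.+-identityʳ _))
composeL-replicate-translation f {i} {t} fi≡+t (suc k) w x = begin
  f i (composeL (map f (replicate k i ++ w)) x)
    ≡⟨ fi≡+t _ ⟩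
  composeL (map f (replicate k i ++ w)) x ℚ.+ t
    ≡⟨ cong (ℚ._+ t) (composeL-replicate-translation f fi≡+t k w x) ⟩
  composeL (map f w) x ℚ.+ ιₙ k ℚ.* t ℚ.+ t
    ≡⟨ solve 3 (λ y k t → y :+ k :* t :+ t := y :+ (con 1ℚ :+ k) :* t) refl (composeL (map f w) x) (ιₙ k) t ⟩
  composeL (map f w) x ℚ.+ (1ℚ ℚ.+ ιₙ k) ℚ.* t
    ≡⟨ cong (λ z → composeL (map f w) x ℚ.+ z ℚ.* t) (ιₙ-homo-+ 1 k) ⟨
  composeL (map f w) x ℚ.+ ιₙ (suc k) ℚ.* t
    ∎
  where
  open ≡-Reasoning
  open ℚ-Solver

translation-collision : ∀ {n} (a : Fin n → ℕ) (b : Fin n → ℚ) {i j} → a i ≡ 1 → j ≢ i → 0 < a j →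
  Collision (SameMap (λ k → affine (a k) (b k)))
translation-collision {n} a b {i} {j} ai≡1 j≢i 0<aj with a j in aj≡ | 0<aj
... | suc m | _ = j ∷ [ i ] , i ∷ (replicate m i ++ [ j ]) , j≢i ∘ cong List⁺.head , λ x → begin
  f j (f i x)
    ≡⟨ cong (f j) (fi≡+b x) ⟩
  ιₙ (a j) ℚ.* (x ℚ.+ b i) ℚ.+ b j
    ≡⟨ solve 4 (λ A x bi bj → A :* (x :+ bi) :+ bj := A :* x :+ bj :+ A :* bi) refl (ιₙ (a j)) x (b i) (b j) ⟩
  f j x ℚ.+ ιₙ (a j) ℚ.* b i
    ≡⟨ cong (λ A → f j x ℚ.+ ιₙ A ℚ.* b i) aj≡ ⟩
  f j x ℚ.+ ιₙ (suc m) ℚ.* b i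
    ≡⟨ composeL-replicate-translation f fi≡+b (suc m) [ j ] x ⟨
  composeL (map f (replicate (suc m) i ++ [ j ])) x
    ∎
  where
  open ≡-Reasoning
  open ℚ-Solver
  f : Fin n → ℚ → ℚ
  f k = affine (a k) (b k)
  fi≡+b : ∀ x → f i x ≡ x ℚ.+ b i
  fi≡+b x = trans (cong (λ A → ιₙ A ℚ.* x ℚ.+ b i) ai≡1) (cong (ℚ._+ b i) (ℚ.*-identityˡ x))

slope-one-collision : ∀ n (a : Fin n → ℕ) (a>0 : ∀ i → 0 < a i) (b : Fin n → ℚ) {i} → a i ≡ 1 →
  1ℚ <ℚ sumFin n (λ i → recip (a i) (a>0 i)) → Collision (SameMap (λ i → affine (a i) (b i)))
slope-one-collision 1 a a>0 b {zero} a0≡1 1<sum =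
  ⊥-elim (ℚ.<-irrefl refl (subst (1ℚ <ℚ_) (trans (ℚ.+-identityʳ _) (recip-1 (a>0 zero) a0≡1)) 1<sum))
  where
  recip-1 : ∀ {m} (m>0 : 0 < m) → m ≡ 1 → recip m m>0 ≡ 1ℚ
  recip-1 _ refl = refl
slope-one-collision (suc (suc n)) a a>0 b {i} ai≡1 _ = translation-collision a b ai≡1 (other≢ i) (a>0 (other i))
  where
  other : Fin (suc (suc n)) → Fin (suc (suc n))
  other zero = suc zero
  other (suc _) = zero
  other≢ : ∀ i → other i ≢ i
  other≢ zero ()
  other≢ (suc _) ()

theorem3 : (n : ℕ) → 1 ≤ n → (a : Fin n → ℕ) → (apos : (i : Fin n) → 0 < a i) → (b : Fin n → ℚ)
  → 1ℚ <ℚ sumFin n (λ i → recip (a i) (apos i))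
  → Σ (List⁺ (Fin n)) (λ is → Σ (List⁺ (Fin n)) (λ js →
      (is ≢ js) × ((x : ℚ) → word (λ i → affine (a i) (b i)) is x ≡ word (λ i → affine (a i) (b i)) js x)))
theorem3 n _ a apos b 1<sum with Fin.any? (λ i → a i ≟ 1)
... | yes (i , ai≡1) = slope-one-collision n a apos b ai≡1 1<sum
... | no ∄a≡1 = expanding-collision n a apos b 2≤a 1<sum
  where
  2≤a : ∀ i → 2 ≤ a i
  2≤a i = ≤∧≢⇒< (apos i) (λ 1≡ai → ∄a≡1 (i , sym 1≡ai))
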